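{- The stabilizer in $\mathrm{SL}_2(\mathbb{Z})^3$ of the Bhargava cube $\mathbf{I}$ (with $\mathbf{I}_{000}=\mathbf{I}_{111}=1$ and all other entries $0$) is the group $\{(I,I,I),(I,-I,-I),(-I,I,-I),(-I,-I,I)\}$, where $I$ is the $2\times2$ identity matrix.
   Context: A Bhargava cube is an integer array $M=(m_{pqr})_{p,q,r\in\{0,1\}}$. The group $\mathrm{SL}_2(\mathbb{Z})^3$ acts on Bhargava cubes by $(A,B,C)M=M'$ with $m'_{ijk}=\sum_{p,q,r=0}^1A_{ip}B_{jq}C_{kr}m_{pqr}$. -}

module Defs where

open import Data.Integer using (ℤ; +_; -_; _+_; _*_; _-_)
open import Data.Fin using (Fin; zero; suc)
open import Data.Product using (_×_; _,_)
open import Data.Sum using (_⊎_)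
open import Relation.Binary.PropositionalEquality using (_≡_)

Mat2 : Set
Mat2 = Fin 2 → Fin 2 → ℤ

det : Mat2 → ℤ
det A = A zero zero * A (suc zero) (suc zero) - A zero (suc zero) * A (suc zero) zero

IsSL2 : Mat2 → Set
IsSL2 A = det A ≡ + 1

Cube : Set
Cube = Fin 2 → Fin 2 → Fin 2 → ℤ

Σ₂ : (Fin 2 → ℤ) → ℤ
Σ₂ f = f zero + f (suc zero)

act : Mat2 → Mat2 → Mat2 → Cube → Cube
act A B C M i j k =
  Σ₂ λ p → Σ₂ λ q → Σ₂ λ r → A i p * B j q * C k r * M p q r

IdCube : Cube
IdCube zero zero zero = + 1
IdCube (suc zero) (suc zero) (suc zero) = + 1
IdCube _ _ _ = + 0

I₂ : Mat2
I₂ zero zero = + 1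
I₂ (suc zero) (suc zero) = + 1
I₂ _ _ = + 0

-I₂ : Mat2
-I₂ i j = - I₂ i j

_≈M_ : Mat2 → Mat2 → Set
A ≈M B = ∀ i j → A i j ≡ B i j

_≈C_ : Cube → Cube → Set
M ≈C N = ∀ i j k → M i j k ≡ N i j k

InKlein : Mat2 → Mat2 → Mat2 → Set
InKlein A B C =
    (A ≈M I₂ × B ≈M I₂ × C ≈M I₂)
  ⊎ (A ≈M I₂ × B ≈M -I₂ × C ≈M -I₂)
  ⊎ (A ≈M -I₂ × B ≈M I₂ × C ≈M -I₂)
  ⊎ (A ≈M -I₂ × B ≈M -I₂ × C ≈M I₂)

-- The slice (A,B,C)𝐈 at first index i is B · diag(Aᵢ₀, Aᵢ₁) · Cᵀ, whose determinant
-- is det B · det C · Aᵢ₀Aᵢ₁.  The slices of 𝐈 are singular, so every row of A has a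
-- zero entry, and by the cyclic symmetry of 𝐈 the same holds for B and C.  The only
-- SL₂(ℤ) matrices with a zero in each row are ±I and ±J, J the quarter turn, and
-- the 4³ resulting triples are checked by computation.
module Submission where

open import Data.Fin using (Fin)
open import Data.Fin.Patterns using (0F; 1F)
open import Data.Fin.Properties using (all?)
open import Data.Integer
  using (ℤ; +_; -_; _+_; _*_; _-_; ∣_∣; 0ℤ; 1ℤ; -1ℤ; -[1+_]; _≟_)
open import Data.Integer.Properties
  using (*-identityˡ; *-zeroʳ; +-identityˡ; +-identityʳ; abs-*; -1*i≡-i; neg-injective;
         neg-distribʳ-*; i*j≡0⇒i≡0∨j≡0; *-commutativeSemigroup)
open import Data.Integer.Tactic.RingSolver using (solve-∀)
open import Data.Nat.Properties using (m*n≡1⇒m≡1)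
open import Data.Product using (_×_; _,_; ∃)
open import Data.Sum using (_⊎_; inj₁; inj₂)
import Data.Sum as Sum
open import Function.Bundles using (_⇔_; mk⇔)
open import Relation.Binary.PropositionalEquality
  using (_≡_; refl; sym; trans; subst; cong; cong₂; module ≡-Reasoning)
open import Relation.Nullary.Decidable
  using (Dec; toWitness; map′; _×-dec_; _⊎-dec_; _→-dec_)

open import Algebra.Properties.CommutativeSemigroup *-commutativeSemigroup
  using (xy∙z≈zx∙y)

open import Defs

private
  variable
    A A′ B B′ C C′ : Mat2

≈M-sym : A ≈M B → B ≈M A
≈M-sym e i j = sym (e i j)

≈M-trans : A ≈M B → B ≈M C → A ≈M C
≈M-trans e f i j = trans (e i j) (f i j)

≈C-trans : ∀ {L M N} → L ≈C M → M ≈C N → L ≈C N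
≈C-trans e f i j k = trans (e i j k) (f i j k)

Σ₂-cong : ∀ {f g : Fin 2 → ℤ} → (∀ s → f s ≡ g s) → Σ₂ f ≡ Σ₂ g
Σ₂-cong e = cong₂ _+_ (e 0F) (e 1F)

det-cong : A ≈M B → det A ≡ det B
det-cong e = cong₂ _-_ (cong₂ _*_ (e 0F 0F) (e 1F 1F)) (cong₂ _*_ (e 0F 1F) (e 1F 0F))

act-cong : ∀ {M M′} → A ≈M A′ → B ≈M B′ → C ≈M C′ → M ≈C M′ →
           act A B C M ≈C act A′ B′ C′ M′
act-cong eA eB eC eM i j k =
  Σ₂-cong λ p → Σ₂-cong λ q → Σ₂-cong λ r →
    cong₂ _*_ (cong₂ _*_ (cong₂ _*_ (eA i p) (eB j q)) (eC k r)) (eM p q r)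

Stabilises : Mat2 → Mat2 → Mat2 → Set
Stabilises A B C = act A B C IdCube ≈C IdCube

stabilises-resp : A ≈M A′ → B ≈M B′ → C ≈M C′ → Stabilises A′ B′ C′ → Stabilises A B C
stabilises-resp eA eB eC = ≈C-trans (act-cong {M = IdCube} eA eB eC λ _ _ _ → refl)

≈M? : (A B : Mat2) → Dec (A ≈M B)
≈M? A B = all? λ i → all? λ j → A i j ≟ B i j

≈C? : (M N : Cube) → Dec (M ≈C N)
≈C? M N = all? λ i → all? λ j → all? λ k → M i j k ≟ N i j k

stabilises? : ∀ A B C → Dec (Stabilises A B C)
stabilises? A B C = ≈C? (act A B C IdCube) IdCube

InKlein? : ∀ A B C → Dec (InKlein A B C)
InKlein? A B C =
        (≈M? A I₂ ×-dec ≈M? B I₂ ×-dec ≈M? C I₂)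
  ⊎-dec (≈M? A I₂ ×-dec ≈M? B -I₂ ×-dec ≈M? C -I₂)
  ⊎-dec (≈M? A -I₂ ×-dec ≈M? B I₂ ×-dec ≈M? C -I₂)
  ⊎-dec (≈M? A -I₂ ×-dec ≈M? B -I₂ ×-dec ≈M? C I₂)

infix 30 _·diag_·ᵀ_

_·diag_·ᵀ_ : Mat2 → (Fin 2 → ℤ) → Mat2 → Mat2
(B ·diag u ·ᵀ C) j k = Σ₂ λ s → u s * B j s * C k s

det-·diag·ᵀ : ∀ B u C → det (B ·diag u ·ᵀ C) ≡ det B * det C * (u 0F * u 1F)
det-·diag·ᵀ B u C =
  identity (B 0F 0F) (B 0F 1F) (B 1F 0F) (B 1F 1F) (u 0F) (u 1F)
           (C 0F 0F) (C 0F 1F) (C 1F 0F) (C 1F 1F)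
  where
  identity : ∀ b₀₀ b₀₁ b₁₀ b₁₁ u₀ u₁ c₀₀ c₀₁ c₁₀ c₁₁ →
    (u₀ * b₀₀ * c₀₀ + u₁ * b₀₁ * c₀₁) * (u₀ * b₁₀ * c₁₀ + u₁ * b₁₁ * c₁₁)
      - (u₀ * b₀₀ * c₁₀ + u₁ * b₀₁ * c₁₁) * (u₀ * b₁₀ * c₀₀ + u₁ * b₁₁ * c₀₁)
    ≡ (b₀₀ * b₁₁ - b₀₁ * b₁₀) * (c₀₀ * c₁₁ - c₀₁ * c₁₀) * (u₀ * u₁)
  identity = solve-∀

act-IdCube : ∀ A B C i → act A B C IdCube i ≈M B ·diag A i ·ᵀ C
act-IdCube A B C i j k =
  identity (A i 0F) (A i 1F) (B j 0F) (B j 1F) (C k 0F) (C k 1F)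
  where
  identity : ∀ a₀ a₁ b₀ b₁ c₀ c₁ →
    ((a₀ * b₀ * c₀ * + 1 + a₀ * b₀ * c₁ * + 0) + (a₀ * b₁ * c₀ * + 0 + a₀ * b₁ * c₁ * + 0))
      + ((a₁ * b₀ * c₀ * + 0 + a₁ * b₀ * c₁ * + 0) + (a₁ * b₁ * c₀ * + 0 + a₁ * b₁ * c₁ * + 1))
    ≡ a₀ * b₀ * c₀ + a₁ * b₁ * c₁
  identity = solve-∀

rotate : Cube → Cube
rotate M i j k = M k i j

act-IdCube-rotate : ∀ A B C → act B C A IdCube ≈C rotate (act A B C IdCube)
act-IdCube-rotate A B C i j k = begin
  act B C A IdCube i j k                 ≡⟨ act-IdCube B C A i j k ⟩
  Σ₂ (λ s → B i s * C j s * A k s)       ≡⟨ Σ₂-cong (λ s → xy∙z≈zx∙y (B i s) (C j s) (A k s)) ⟩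
  Σ₂ (λ s → A k s * B i s * C j s)       ≡⟨ act-IdCube A B C k i j ⟨
  act A B C IdCube k i j                 ∎
  where open ≡-Reasoning

rotate-IdCube : rotate IdCube ≈C IdCube
rotate-IdCube = toWitness {a? = ≈C? (rotate IdCube) IdCube} _

stabilises-rotate : ∀ A B C → Stabilises A B C → Stabilises B C A
stabilises-rotate A B C h i j k =
  trans (act-IdCube-rotate A B C i j k) (trans (h k i j) (rotate-IdCube i j k))

det-IdCube-slice : ∀ i → det (IdCube i) ≡ 0ℤ
det-IdCube-slice 0F = refl
det-IdCube-slice 1F = refl

stabilises⇒rows-degenerate : ∀ A B C → IsSL2 B → IsSL2 C → Stabilises A B C →
                             ∀ i → A i 0F * A i 1F ≡ 0ℤ
stabilises⇒rows-degenerate A B C det-B det-C h i = begin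
  A i 0F * A i 1F                        ≡⟨ *-identityˡ _ ⟨
  1ℤ * 1ℤ * (A i 0F * A i 1F)            ≡⟨ cong₂ (λ x y → x * y * (A i 0F * A i 1F)) det-B det-C ⟨
  det B * det C * (A i 0F * A i 1F)      ≡⟨ det-·diag·ᵀ B (A i) C ⟨
  det (B ·diag A i ·ᵀ C)                 ≡⟨ det-cong (act-IdCube A B C i) ⟨
  det (act A B C IdCube i)               ≡⟨ det-cong (h i) ⟩
  det (IdCube i)                         ≡⟨ det-IdCube-slice i ⟩
  0ℤ                                     ∎
  where open ≡-Reasoning

∣i∣≡1⇒i≡±1 : ∀ i → ∣ i ∣ ≡ 1 → i ≡ 1ℤ ⊎ i ≡ -1ℤ
∣i∣≡1⇒i≡±1 (+ 1)     _ = inj₁ refl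
∣i∣≡1⇒i≡±1 -[1+ 0 ]  _ = inj₂ refl

i*j≡1⇒i≡j≡±1 : ∀ i j → i * j ≡ 1ℤ → (i ≡ 1ℤ × j ≡ 1ℤ) ⊎ (i ≡ -1ℤ × j ≡ -1ℤ)
i*j≡1⇒i≡j≡±1 i j ij≡1
  with ∣i∣≡1⇒i≡±1 i (m*n≡1⇒m≡1 ∣ i ∣ ∣ j ∣ (trans (sym (abs-* i j)) (cong ∣_∣ ij≡1)))
... | inj₁ refl = inj₁ (refl , trans (sym (*-identityˡ j)) ij≡1)
... | inj₂ refl = inj₂ (refl , neg-injective (trans (sym (-1*i≡-i j)) ij≡1))

data SignedPerm : Set where
  +I -I +J -J : SignedPerm

mat : ℤ → ℤ → ℤ → ℤ → Mat2
mat a b c d 0F 0F = a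
mat a b c d 0F 1F = b
mat a b c d 1F 0F = c
mat a b c d 1F 1F = d

⟦_⟧ : SignedPerm → Mat2
⟦ +I ⟧ = mat 1ℤ 0ℤ 0ℤ 1ℤ
⟦ -I ⟧ = mat -1ℤ 0ℤ 0ℤ -1ℤ
⟦ +J ⟧ = mat 0ℤ 1ℤ -1ℤ 0ℤ
⟦ -J ⟧ = mat 0ℤ -1ℤ 1ℤ 0ℤ

mat-entries : (A : Mat2) → A ≈M mat (A 0F 0F) (A 0F 1F) (A 1F 0F) (A 1F 1F)
mat-entries A 0F 0F = refl
mat-entries A 0F 1F = refl
mat-entries A 1F 0F = refl
mat-entries A 1F 1F = refl

signedPerm-of-entries : ∀ a b c d → det (mat a b c d) ≡ 1ℤ → a * b ≡ 0ℤ → c * d ≡ 0ℤ →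
                        ∃ λ s → ⟦ s ⟧ ≡ mat a b c d
signedPerm-of-entries a b c d det≡1 ab≡0 cd≡0
  with i*j≡0⇒i≡0∨j≡0 a ab≡0 | i*j≡0⇒i≡0∨j≡0 c cd≡0
... | inj₁ refl | inj₁ refl with () ← trans (sym det≡1) (cong (λ x → 0ℤ - x) (*-zeroʳ b))
... | inj₂ refl | inj₂ refl with () ← trans (sym det≡1) (cong (λ x → x - 0ℤ * c) (*-zeroʳ a))
... | inj₂ refl | inj₁ refl with i*j≡1⇒i≡j≡±1 a d (trans (sym (+-identityʳ (a * d))) det≡1)
...   | inj₁ (refl , refl) = +I , refl
...   | inj₂ (refl , refl) = -I , refl
signedPerm-of-entries a b c d det≡1 ab≡0 cd≡0 | inj₁ refl | inj₂ refl
  with i*j≡1⇒i≡j≡±1 b (- c) (trans (sym (neg-distribʳ-* b c)) (trans (sym (+-identityˡ _)) det≡1))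
... | inj₁ (refl , -c≡1)  with refl ← neg-injective {j = -1ℤ} -c≡1 = +J , refl
... | inj₂ (refl , -c≡-1) with refl ← neg-injective {j = 1ℤ} -c≡-1 = -J , refl

signedPerm-of-degenerate-rows : IsSL2 A → (∀ i → A i 0F * A i 1F ≡ 0ℤ) → ∃ λ s → A ≈M ⟦ s ⟧
signedPerm-of-degenerate-rows {A} det≡1 rows
  with signedPerm-of-entries (A 0F 0F) (A 0F 1F) (A 1F 0F) (A 1F 1F) det≡1 (rows 0F) (rows 1F)
... | s , ⟦s⟧≡A = s , subst (A ≈M_) (sym ⟦s⟧≡A) (mat-entries A)

∀-SignedPerm? : {P : SignedPerm → Set} → (∀ s → Dec (P s)) → Dec (∀ s → P s)
∀-SignedPerm? P? = map′ (λ { (p , q , r , t) +I → p ; (p , q , r , t) -I → q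
                           ; (p , q , r , t) +J → r ; (p , q , r , t) -J → t })
                        (λ p → p +I , p -I , p +J , p -J)
                        (P? +I ×-dec P? -I ×-dec P? +J ×-dec P? -J)

stabilises-signedPerm⇒InKlein : ∀ a b c → Stabilises ⟦ a ⟧ ⟦ b ⟧ ⟦ c ⟧ → InKlein ⟦ a ⟧ ⟦ b ⟧ ⟦ c ⟧
stabilises-signedPerm⇒InKlein =
  toWitness {a? = ∀-SignedPerm? λ a → ∀-SignedPerm? λ b → ∀-SignedPerm? λ c →
                  stabilises? ⟦ a ⟧ ⟦ b ⟧ ⟦ c ⟧ →-dec InKlein? ⟦ a ⟧ ⟦ b ⟧ ⟦ c ⟧} _

InKlein-resp : A ≈M A′ → B ≈M B′ → C ≈M C′ → InKlein A′ B′ C′ → InKlein A B C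
InKlein-resp {A} {A′} {B} {B′} {C} {C′} eA eB eC =
  Sum.map along (Sum.map along (Sum.map along along))
  where
  along : ∀ {X Y Z} → A′ ≈M X × B′ ≈M Y × C′ ≈M Z → A ≈M X × B ≈M Y × C ≈M Z
  along (p , q , r) = ≈M-trans eA p , ≈M-trans eB q , ≈M-trans eC r

stabilises⇒InKlein : IsSL2 A → IsSL2 B → IsSL2 C → Stabilises A B C → InKlein A B C
stabilises⇒InKlein {A} {B} {C} det-A det-B det-C h
  with signedPerm-of-degenerate-rows det-A (stabilises⇒rows-degenerate A B C det-B det-C h)
     | signedPerm-of-degenerate-rows det-B (stabilises⇒rows-degenerate B C A det-C det-A hBCA)
     | signedPerm-of-degenerate-rows det-C (stabilises⇒rows-degenerate C A B det-A det-B hCAB)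
  where
  hBCA : Stabilises B C A
  hBCA = stabilises-rotate A B C h
  hCAB : Stabilises C A B
  hCAB = stabilises-rotate B C A hBCA
... | a , A≈a | b , B≈b | c , C≈c =
  InKlein-resp A≈a B≈b C≈c
    (stabilises-signedPerm⇒InKlein a b c (stabilises-resp (≈M-sym A≈a) (≈M-sym B≈b) (≈M-sym C≈c) h))

InKlein⇒stabilises : InKlein A B C → Stabilises A B C
InKlein⇒stabilises (inj₁ (eA , eB , eC)) =
  stabilises-resp eA eB eC (toWitness {a? = stabilises? I₂ I₂ I₂} _)
InKlein⇒stabilises (inj₂ (inj₁ (eA , eB , eC))) =
  stabilises-resp eA eB eC (toWitness {a? = stabilises? I₂ -I₂ -I₂} _)
InKlein⇒stabilises (inj₂ (inj₂ (inj₁ (eA , eB , eC)))) =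
  stabilises-resp eA eB eC (toWitness {a? = stabilises? -I₂ I₂ -I₂} _)
InKlein⇒stabilises (inj₂ (inj₂ (inj₂ (eA , eB , eC)))) =
  stabilises-resp eA eB eC (toWitness {a? = stabilises? -I₂ -I₂ I₂} _)

theorem9p2 : (A B C : Mat2) → IsSL2 A → IsSL2 B → IsSL2 C →
    (act A B C IdCube ≈C IdCube) ⇔ InKlein A B C
theorem9p2 A B C det-A det-B det-C =
  mk⇔ (stabilises⇒InKlein det-A det-B det-C) InKlein⇒stabilises
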